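{- Let $A$ be a thin concurrent game and $\hat x\in\mathscr C(A)$ a canonical configuration. Let $x\in\mathscr C(A)$ with $x\cong^+_A\hat x$. Then every symmetry $\theta:x\cong_A\hat x$ factors uniquely as $\theta=\theta^-\circ\theta^+$ with $\theta^+:x\cong^+_A\hat x$ and $\theta^-:\hat x\cong^-_A\hat x$.
   Context: An event structure: countable set of events, partial order $\le$ with finite down-sets, irreflexive symmetric conflict $\#$ with $e_1\#e_2\le e_2'\Rightarrow e_1\#e_2'$; configurations are finite down-closed conflict-free sets ($\mathscr C(A)$). An isomorphism family $\tilde A$: bijections between configurations, containing identities, closed under composition and inverse, each with a unique restriction to any sub-configuration of its domain and some extension to any configuration containing its domain; write $\theta:x\cong_Ay$. A thin concurrent game $A$ is such a structure with a polarity $\mathrm{pol}_A:|A|\to\{ -,+\}$ preserved by symmetries and two isomorphism families $\tilde A_+,\tilde A_-\subseteq\tilde A$ (positive/negative symmetries, written $\cong^+_A,\cong^-_A$) with $\tilde A_+\cap\tilde A_-$ consisting only of identities, and such that if $\theta\in\tilde A_-$ (resp. $\tilde A_+$) and $\theta\subseteq\theta'\in\tilde A$ with $\theta'\setminus\theta$ consisting of pairs of negative (resp. positive) events then $\theta'\in\tilde A_-$ (resp. $\tilde A_+$). A configuration $x$ is canonical if every $\theta:x\cong_Ax$ factors uniquely as $\theta=\theta^+\circ\theta^-$ with $\theta^-:x\cong^-_Ax$ and $\theta^+:x\cong^+_Ax$. -}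

module Defs where

open import Data.Nat using (ℕ)
open import Data.List using (List)
open import Data.List.Membership.Propositional using (_∈_)
open import Data.Product using (Σ; ∃; _×_; _,_)
open import Relation.Nullary using (¬_)
open import Relation.Binary.PropositionalEquality using (_≡_)

_⟺_ : Set → Set → Set
A ⟺ B = (A → B) × (B → A)

record EventStructure : Set₁ where
  field
    E        : Set
    -- countability: an injection into ℕ
    enc      : E → ℕ
    enc-inj  : ∀ {a b} → enc a ≡ enc b → a ≡ b
    _≤E_     : E → E → Set
    ≤E-refl  : ∀ e → e ≤E e
    ≤E-trans : ∀ {a b c} → a ≤E b → b ≤E c → a ≤E c
    ≤E-antisym : ∀ {a b} → a ≤E b → b ≤E a → a ≡ b
    down-finite : ∀ e → Σ (List E) λ l → ∀ e' → (e' ≤E e) ⟺ (e' ∈ l)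
    _#_      : E → E → Set
    #-irrefl : ∀ e → ¬ (e # e)
    #-sym    : ∀ {a b} → a # b → b # a
    #-her    : ∀ {e₁ e₂ e₂'} → e₁ # e₂ → e₂ ≤E e₂' → e₁ # e₂'

module _ (ES : EventStructure) where
  open EventStructure ES

  Subset : Set₁
  Subset = E → Set

  Rel : Set₁
  Rel = E → E → Set

  _⊆_ : Subset → Subset → Set
  x ⊆ y = ∀ e → x e → y e

  _≐_ : Subset → Subset → Set
  x ≐ y = ∀ e → x e ⟺ y e

  Finite : Subset → Set
  Finite x = Σ (List E) λ l → ∀ e → x e ⟺ (e ∈ l)

  isConfig : Subset → Set
  isConfig x = Finite x
             × (∀ {e e'} → e' ≤E e → x e → x e')
             × (∀ {e e'} → x e → x e' → ¬ (e # e'))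

  _≈R_ : Rel → Rel → Set
  θ ≈R φ = ∀ e e' → θ e e' ⟺ φ e e'

  _⊆R_ : Rel → Rel → Set
  θ ⊆R φ = ∀ e e' → θ e e' → φ e e'

  domR : Rel → Subset
  domR θ e = ∃ λ e' → θ e e'

  codR : Rel → Subset
  codR θ e' = ∃ λ e → θ e e'

  idR : Subset → Rel
  idR x e e' = x e × e ≡ e'

  -- φ ∘R θ : first θ, then φ
  _∘R_ : Rel → Rel → Rel
  (φ ∘R θ) e e'' = ∃ λ e' → θ e e' × φ e' e''

  _⁻¹R : Rel → Rel
  (θ ⁻¹R) e e' = θ e' e

  restrictR : Rel → Subset → Rel
  restrictR θ z e e' = z e × θ e e'

  IsBij : Rel → Subset → Subset → Set
  IsBij θ x y = isConfig x × isConfig y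
              × (domR θ ≐ x) × (codR θ ≐ y)
              × (∀ {e a b} → θ e a → θ e b → a ≡ b)
              × (∀ {a b e} → θ a e → θ b e → a ≡ b)

  record IsoFamily : Set₁ where
    field
      Iso       : Rel → Set
      Iso-resp  : ∀ {θ φ} → θ ≈R φ → Iso θ → Iso φ
      Iso-bij   : ∀ {θ} → Iso θ → IsBij θ (domR θ) (codR θ)
      Iso-id    : ∀ x → isConfig x → Iso (idR x)
      Iso-comp  : ∀ {θ φ} → Iso θ → Iso φ → codR θ ≐ domR φ → Iso (φ ∘R θ)
      Iso-inv   : ∀ {θ} → Iso θ → Iso (θ ⁻¹R)
      -- restriction (necessarily unique as a relation) to sub-configurations
      Iso-restrict : ∀ {θ} z → Iso θ → isConfig z → z ⊆ domR θ → Iso (restrictR θ z)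
      Iso-extend : ∀ {θ} z → Iso θ → isConfig z → domR θ ⊆ z →
                   Σ Rel λ θ' → Iso θ' × θ ⊆R θ' × (domR θ' ≐ z)

  _∶_≅[_]_ : Rel → Subset → IsoFamily → Subset → Set
  θ ∶ x ≅[ F ] y = IsoFamily.Iso F θ × (domR θ ≐ x) × (codR θ ≐ y)

  UniqueFactorisation : (Rel → Set) → (Rel → Set) → Rel → Set₁
  UniqueFactorisation P Q θ =
    Σ Rel λ f → Σ Rel λ g → (P f × Q g × θ ≈R (g ∘R f))
      × (∀ f' g' → P f' → Q g' → θ ≈R (g' ∘R f') → (f ≈R f') × (g ≈R g'))

data Pol : Set where
  neg pos : Pol

record ThinGame : Set₂ where
  field
    ES    : EventStructure
  open EventStructure ES public
  field
    sym   : IsoFamily ES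
    symP  : IsoFamily ES
    symN  : IsoFamily ES
    pol   : E → Pol
    pol-pres : ∀ {θ e e'} → IsoFamily.Iso sym θ → θ e e' → pol e ≡ pol e'
    symP⊆ : ∀ {θ} → IsoFamily.Iso symP θ → IsoFamily.Iso sym θ
    symN⊆ : ∀ {θ} → IsoFamily.Iso symN θ → IsoFamily.Iso sym θ
    P∩N-id : ∀ {θ} → IsoFamily.Iso symP θ → IsoFamily.Iso symN θ →
             _≈R_ ES θ (idR ES (domR ES θ))
    N-ext : ∀ {θ θ'} → IsoFamily.Iso symN θ → _⊆R_ ES θ θ' → IsoFamily.Iso sym θ' →
            (∀ e e' → θ' e e' → ¬ θ e e' → pol e ≡ neg × pol e' ≡ neg) →
            IsoFamily.Iso symN θ'
    P-ext : ∀ {θ θ'} → IsoFamily.Iso symP θ → _⊆R_ ES θ θ' → IsoFamily.Iso sym θ' →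
            (∀ e e' → θ' e e' → ¬ θ e e' → pol e ≡ pos × pol e' ≡ pos) →
            IsoFamily.Iso symP θ'

module _ (A : ThinGame) where
  open ThinGame A

  Canonical : Subset ES → Set₁
  Canonical x = isConfig ES x ×
    (∀ θ → _∶_≅[_]_ ES θ x sym x →
       UniqueFactorisation ES (λ f → _∶_≅[_]_ ES f x symN x)
                              (λ g → _∶_≅[_]_ ES g x symP x) θ)

-- Transport along ψ : x ≅⁺ x̂.  The composite σ = ψ ∘ θ⁻¹ is a symmetry x̂ ≅ x̂, and
-- factorisations θ = θ⁻ ∘ θ⁺ correspond to factorisations σ = σ⁺ ∘ σ⁻ through
-- (θ⁺ , θ⁻) ↦ (θ⁻⁻¹ , ψ ∘ θ⁺⁻¹), with inverse (σ⁻ , σ⁺) ↦ (σ⁺⁻¹ ∘ ψ , σ⁻⁻¹).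
-- Existence and uniqueness for θ are thus inherited from the canonicity of x̂.
module Submission where

open import Level using (0ℓ) renaming (suc to lsuc)
open import Data.Product using (Σ; _×_; _,_; proj₁; proj₂; map₁)
open import Relation.Binary.Bundles using (Setoid)
open import Relation.Binary.PropositionalEquality using (_≡_; subst)
import Relation.Binary.Reasoning.Setoid as SetoidReasoning
open import Defs using (EventStructure; IsoFamily; ThinGame; Subset; Rel; isConfig;
  _∶_≅[_]_; UniqueFactorisation; Canonical)
import Defs as D

module RelationAlgebra (ES : EventStructure) where

  infix  4 _≈R_ _≐_
  infixr 9 _∘R_
  infix  10 _⁻¹R

  _≐_ : Subset ES → Subset ES → Set
  _≐_ = D._≐_ ES

  _≈R_ : Rel ES → Rel ES → Set
  _≈R_ = D._≈R_ ES

  _∘R_ : Rel ES → Rel ES → Rel ES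
  _∘R_ = D._∘R_ ES

  _⁻¹R : Rel ES → Rel ES
  _⁻¹R = D._⁻¹R ES

  domR codR : Rel ES → Subset ES
  domR = D.domR ES
  codR = D.codR ES

  Injective : Rel ES → Set
  Injective θ = ∀ {a b e} → θ a e → θ b e → a ≡ b

  ≐-sym : ∀ {x y} → x ≐ y → y ≐ x
  ≐-sym p e = proj₂ (p e) , proj₁ (p e)

  ≐-trans : ∀ {x y z} → x ≐ y → y ≐ z → x ≐ z
  ≐-trans p q e = (λ h → proj₁ (q e) (proj₁ (p e) h)) , (λ h → proj₂ (p e) (proj₂ (q e) h))

  ≈R-setoid : Setoid (lsuc 0ℓ) 0ℓ
  ≈R-setoid = record
    { Carrier       = Rel ES
    ; _≈_           = _≈R_
    ; isEquivalence = record
      { refl  = λ _ _ → (λ h → h) , (λ h → h)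
      ; sym   = λ p a b → proj₂ (p a b) , proj₁ (p a b)
      ; trans = λ p q a b → (λ h → proj₁ (q a b) (proj₁ (p a b) h))
                          , (λ h → proj₂ (p a b) (proj₂ (q a b) h))
      }
    }

  open Setoid ≈R-setoid public using () renaming (refl to ≈R-refl)

  ∘R-cong : ∀ {φ φ' θ θ'} → φ ≈R φ' → θ ≈R θ' → φ ∘R θ ≈R φ' ∘R θ'
  ∘R-cong p q a c =
      (λ { (b , t , f) → b , proj₁ (q a b) t , proj₁ (p b c) f })
    , (λ { (b , t , f) → b , proj₂ (q a b) t , proj₂ (p b c) f })

  ∘R-assoc : ∀ χ φ θ → (χ ∘R φ) ∘R θ ≈R χ ∘R (φ ∘R θ)
  ∘R-assoc χ φ θ a d =
      (λ { (b , t , c , f , h) → c , (b , t , f) , h })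
    , (λ { (c , (b , t , f) , h) → b , t , c , f , h })

  ⁻¹R-cong : ∀ {θ θ'} → θ ≈R θ' → θ ⁻¹R ≈R θ' ⁻¹R
  ⁻¹R-cong p a b = p b a

  ⁻¹R-anti-∘R : ∀ φ θ → (φ ∘R θ) ⁻¹R ≈R θ ⁻¹R ∘R φ ⁻¹R
  ⁻¹R-anti-∘R φ θ a c =
      (λ { (b , t , f) → b , f , t })
    , (λ { (b , f , t) → b , t , f })

  domR-∘R : ∀ {φ θ} → codR θ ≐ domR φ → domR (φ ∘R θ) ≐ domR θ
  domR-∘R mid a =
      (λ { (c , b , t , _) → b , t })
    , (λ { (b , t) → let (c , f) = proj₁ (mid b) (a , t) in c , b , t , f })

  codR-∘R : ∀ {φ θ} → codR θ ≐ domR φ → codR (φ ∘R θ) ≐ codR φ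
  codR-∘R mid c =
      (λ { (a , b , _ , f) → b , f })
    , (λ { (b , f) → let (a , t) = proj₂ (mid b) (c , f) in a , b , t , f })

  -- A pair (a , b) of the left side comes with ψ a c, φ d b and ψ d c; injectivity gives d = a.
  ⁻¹R-∘R-cancel : ∀ {ψ} φ → Injective ψ → domR φ ≐ domR ψ → (ψ ∘R φ ⁻¹R) ⁻¹R ∘R ψ ≈R φ
  ⁻¹R-∘R-cancel {ψ} φ ψ-inj dom a b =
      (λ { (c , t , d , f , t') → subst (λ z → φ z b) (ψ-inj t' t) f })
    , (λ f → let (c , t) = proj₁ (dom a) (b , f) in c , t , a , f , t)

module Isomorphisms (ES : EventStructure) where
  open RelationAlgebra ES
  open IsoFamily

  infix 4 _∶_≅⟨_⟩_

  _∶_≅⟨_⟩_ : Rel ES → Subset ES → IsoFamily ES → Subset ES → Set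
  θ ∶ x ≅⟨ F ⟩ y = _∶_≅[_]_ ES θ x F y

  ≅-injective : ∀ F {θ x y} → θ ∶ x ≅⟨ F ⟩ y → Injective θ
  ≅-injective F (θI , _) = proj₂ (proj₂ (proj₂ (proj₂ (proj₂ (Iso-bij F θI)))))

  ≅-sym : ∀ F {θ x y} → θ ∶ x ≅⟨ F ⟩ y → θ ⁻¹R ∶ y ≅⟨ F ⟩ x
  ≅-sym F (θI , dom , cod) = Iso-inv F θI , cod , dom

  ≅-trans : ∀ F {θ φ x y z} → θ ∶ x ≅⟨ F ⟩ y → φ ∶ y ≅⟨ F ⟩ z → φ ∘R θ ∶ x ≅⟨ F ⟩ z
  ≅-trans F {θ} {φ} (θI , θdom , θcod) (φI , φdom , φcod) =
      Iso-comp F θI φI mid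
    , ≐-trans (domR-∘R {φ} {θ} mid) θdom
    , ≐-trans (codR-∘R {φ} {θ} mid) φcod
    where
    mid : codR θ ≐ domR φ
    mid = ≐-trans θcod (≐-sym φdom)

  ≅-⁻¹R-∘R-cancel : ∀ F {ψ φ x y} → ψ ∶ x ≅⟨ F ⟩ y → domR φ ≐ x →
                    (ψ ∘R φ ⁻¹R) ⁻¹R ∘R ψ ≈R φ
  ≅-⁻¹R-∘R-cancel F {φ = φ} ψ≅@(_ , ψdom , _) φdom =
    ⁻¹R-∘R-cancel φ (≅-injective F ψ≅) (≐-trans φdom (≐-sym ψdom))

module Transport (A : ThinGame) {x x̂ : Subset (ThinGame.ES A)} {ψ θ : Rel (ThinGame.ES A)} where
  open ThinGame A using (ES; symP; symN; symP⊆) renaming (sym to symA)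
  open RelationAlgebra ES
  open Isomorphisms ES
  open SetoidReasoning ≈R-setoid

  module _ (ψ⁺ : ψ ∶ x ≅⟨ symP ⟩ x̂) (θ≅ : θ ∶ x ≅⟨ symA ⟩ x̂) where

    σ : Rel ES
    σ = ψ ∘R θ ⁻¹R

    σ-endo : σ ∶ x̂ ≅⟨ symA ⟩ x̂
    σ-endo = ≅-trans symA (≅-sym symA θ≅) (map₁ symP⊆ ψ⁺)

    σ-factors : ∀ {f g} → θ ≈R g ∘R f → σ ≈R (ψ ∘R f ⁻¹R) ∘R g ⁻¹R
    σ-factors {f} {g} θ≈ = begin
      ψ ∘R θ ⁻¹R                ≈⟨ ∘R-cong ≈R-refl (⁻¹R-cong θ≈) ⟩
      ψ ∘R (g ∘R f) ⁻¹R         ≈⟨ ∘R-cong ≈R-refl (⁻¹R-anti-∘R g f) ⟩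
      ψ ∘R f ⁻¹R ∘R g ⁻¹R       ≈⟨ ∘R-assoc ψ (f ⁻¹R) (g ⁻¹R) ⟨
      (ψ ∘R f ⁻¹R) ∘R g ⁻¹R     ∎

    θ-factors : ∀ {f g} → σ ≈R g ∘R f → θ ≈R f ⁻¹R ∘R g ⁻¹R ∘R ψ
    θ-factors {f} {g} σ≈ = begin
      θ                         ≈⟨ ≅-⁻¹R-∘R-cancel symP ψ⁺ (proj₁ (proj₂ θ≅)) ⟨
      σ ⁻¹R ∘R ψ                ≈⟨ ∘R-cong (⁻¹R-cong σ≈) ≈R-refl ⟩
      (g ∘R f) ⁻¹R ∘R ψ         ≈⟨ ∘R-cong (⁻¹R-anti-∘R g f) ≈R-refl ⟩
      (f ⁻¹R ∘R g ⁻¹R) ∘R ψ     ≈⟨ ∘R-assoc (f ⁻¹R) (g ⁻¹R) ψ ⟩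
      f ⁻¹R ∘R g ⁻¹R ∘R ψ       ∎

    factorisation-transport :
      UniqueFactorisation ES (λ f → f ∶ x̂ ≅⟨ symN ⟩ x̂) (λ g → g ∶ x̂ ≅⟨ symP ⟩ x̂) σ →
      UniqueFactorisation ES (λ f → f ∶ x ≅⟨ symP ⟩ x̂) (λ g → g ∶ x̂ ≅⟨ symN ⟩ x̂) θ
    factorisation-transport (f , g , (f⁻ , g⁺ , σ≈) , σ-unique) =
        g ⁻¹R ∘R ψ , f ⁻¹R
      , (≅-trans symP ψ⁺ (≅-sym symP g⁺) , ≅-sym symN f⁻ , θ-factors σ≈)
      , unique
      where
      unique : ∀ f' g' → f' ∶ x ≅⟨ symP ⟩ x̂ → g' ∶ x̂ ≅⟨ symN ⟩ x̂ → θ ≈R g' ∘R f' →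
               (g ⁻¹R ∘R ψ ≈R f') × (f ⁻¹R ≈R g')
      unique f' g' f'⁺ g'⁻ θ≈
        with σ-unique (g' ⁻¹R) (ψ ∘R f' ⁻¹R)
                      (≅-sym symN g'⁻) (≅-trans symP (≅-sym symP f'⁺) ψ⁺) (σ-factors θ≈)
      ... | f≈ , g≈ = positive-part , ⁻¹R-cong f≈
        where
        positive-part : g ⁻¹R ∘R ψ ≈R f'
        positive-part = begin
          g ⁻¹R ∘R ψ                ≈⟨ ∘R-cong (⁻¹R-cong g≈) ≈R-refl ⟩
          (ψ ∘R f' ⁻¹R) ⁻¹R ∘R ψ    ≈⟨ ≅-⁻¹R-∘R-cancel symP ψ⁺ (proj₁ (proj₂ f'⁺)) ⟩
          f'                        ∎

lemmaC6 : (A : ThinGame) (x̂ : Subset (ThinGame.ES A)) → Canonical A x̂ →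
    (x : Subset (ThinGame.ES A)) → isConfig (ThinGame.ES A) x →
    Σ (Rel (ThinGame.ES A)) (λ ψ → _∶_≅[_]_ (ThinGame.ES A) ψ x (ThinGame.symP A) x̂) →
    (θ : Rel (ThinGame.ES A)) → _∶_≅[_]_ (ThinGame.ES A) θ x (ThinGame.sym A) x̂ →
    UniqueFactorisation (ThinGame.ES A)
    (λ f → _∶_≅[_]_ (ThinGame.ES A) f x (ThinGame.symP A) x̂)
    (λ g → _∶_≅[_]_ (ThinGame.ES A) g x̂ (ThinGame.symN A) x̂) θ
lemmaC6 A x̂ (_ , canonical) x _ (ψ , ψ⁺) θ θ≅ =
  factorisation-transport ψ⁺ θ≅ (canonical (σ ψ⁺ θ≅) (σ-endo ψ⁺ θ≅))
  where open Transport A
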